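{- A finite graph $H$ is an induced subgraph of the up and right graph if and only if $H$ is a permutation graph.
   Context: The up and right graph has vertex set $\mathbb{Q}\times\mathbb{Q}$, and distinct vertices $(q,r)$ and $(s,t)$ are adjacent if and only if either ($q+r\sqrt2<s+t\sqrt2$ and $q-r\sqrt2<s-t\sqrt2$) or ($q+r\sqrt2>s+t\sqrt2$ and $q-r\sqrt2>s-t\sqrt2$). A finite graph is a permutation graph if its vertices can be labelled $v_1,\dots,v_n$ such that for some permutation $\sigma$ of $\{1,\dots,n\}$, for all $i<j$, $v_iv_j$ is an edge if and only if $\sigma(i)<\sigma(j)$. -}

module Defs where

open import Data.Nat using (ℕ)
open import Data.Fin using (Fin) renaming (_<_ to _<ᶠ_)
open import Data.Fin.Permutation using (Permutation′; _⟨$⟩ʳ_)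
open import Data.Rational using (ℚ; 0ℚ; _<_; _≤_; _-_; _*_; _+_; 1ℚ; -_)
open import Data.Product using (_×_; Σ; ∃)
open import Data.Sum using (_⊎_)
open import Relation.Nullary using (¬_)
open import Relation.Binary.PropositionalEquality using (_≡_; _≢_)
open import Function.Bundles using (_⇔_)
open import Function.Definitions using (Injective)

-- The number a + b√2 (a b : ℚ) is written as the pair (a , b).
-- Pos√2 a b  means  a + b√2 > 0  (written out with rational arithmetic only,
-- since √2 is irrational): exactly one of the following cases holds.
2ℚ : ℚ
2ℚ = 1ℚ + 1ℚ

Pos√2 : ℚ → ℚ → Set
Pos√2 a b =
    (0ℚ ≤ a × 0ℚ ≤ b × ¬ (a ≡ 0ℚ × b ≡ 0ℚ))
  ⊎ (0ℚ < a × b < 0ℚ × 2ℚ * (b * b) < a * a)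
  ⊎ (a < 0ℚ × 0ℚ < b × a * a < 2ℚ * (b * b))

_+_√2<_+_√2 : ℚ → ℚ → ℚ → ℚ → Set
x + y √2< z + w √2 = Pos√2 (z - x) (w - y)

V : Set
V = ℚ × ℚ

URAdj : V → V → Set
URAdj (q Data.Product., r) (s Data.Product., t) =
    (q ≢ s ⊎ r ≢ t)
  × ( ((q + r √2< s + t √2) × (q + (- r) √2< s + (- t) √2))
    ⊎ ((s + t √2< q + r √2) × (s + (- t) √2< q + (- r) √2)) )

record FinGraph : Set₁ where
  field
    n     : ℕ
    E     : Fin n → Fin n → Set
    sym   : ∀ {i j} → E i j → E j i
    irrefl : ∀ {i} → ¬ E i i

IsInducedSubgraphOfUR : FinGraph → Set
IsInducedSubgraphOfUR H =
  Σ (Fin n → V) λ f → Injective _≡_ _≡_ f × (∀ i j → i ≢ j → (E i j ⇔ URAdj (f i) (f j)))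
  where open FinGraph H

IsPermutationGraph : FinGraph → Set
IsPermutationGraph H =
  Σ (Permutation′ n) λ π → Σ (Permutation′ n) λ σ →
    ∀ i j → i <ᶠ j → (E (π ⟨$⟩ʳ i) (π ⟨$⟩ʳ j) ⇔ (σ ⟨$⟩ʳ i) <ᶠ (σ ⟨$⟩ʳ j))
  where open FinGraph H

{-# OPTIONS --safe #-}
module Submission where

-- Write u(q , r) = q + r√2 and w(q , r) = q − r√2, so that two distinct points are adjacent
-- in the up and right graph iff their u-order and their w-order agree.  Ranking the vertices
-- of an induced subgraph by u and by w therefore exhibits it as a permutation graph.
-- Conversely, given the labelling i ↦ σ(i), take a solution of p² − 2q² = −1 with p ≥ n,
-- put α = p + q√2 and β = p − q√2 = −1/α, and place vertex i at the point with
-- u = α i + β σ(i) and w = β i + α σ(i).  As |β| n < α, the u-order is the order of the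
-- labels i and the w-order is the order of the σ(i).
-- Everything is carried out over ℚ: a + b√2 > 0 iff a + b t > 0 at both ends of a rational
-- interval around √2, which makes positivity closed under addition, and the irrationality
-- of √2 makes the order total.

open import Level using (0ℓ)
open import Data.List using (_∷_; [])
open import Data.Nat as ℕ using (ℕ; zero; suc)
import Data.Nat.Properties as ℕ
open import Data.Nat.Divisibility using (_∣_; divides)
open import Data.Nat.Induction using (<-rec)
open import Data.Nat.Primality using (prime?; euclidsLemma)
import Data.Nat.Tactic.RingSolver as ℕ-Solver
import Data.Integer as ℤ
import Data.Integer.Properties as ℤ
open import Data.Bool.Properties using (T-≡)
open import Data.Fin using (Fin; toℕ; fromℕ<; punchOut) renaming (_<_ to _<ᶠ_)
open import Data.Fin.Properties
  using (any?; punchOut-injective; injective⇒≤; toℕ-fromℕ<; toℕ<n)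
  renaming (_≟_ to _≟ᶠ_; <-cmp to <ᶠ-cmp)
open import Data.Fin.Permutation
  using (Permutation′; permutation; _⟨$⟩ʳ_; _⟨$⟩ˡ_; flip; _∘ₚ_; inverseˡ; inverseʳ)
open import Data.Fin.Subset using (Subset; _∈_; _⊂_; ∣_∣)
open import Data.Fin.Subset.Properties using (p⊂q⇒∣p∣<∣q∣; ⊆⊤; ∈⊤; ∣⊤∣≡n)
open import Data.Vec using (tabulate)
open import Data.Vec.Properties using (lookup∘tabulate; []=⇒lookup; lookup⇒[]=)
open import Data.Product using (Σ; ∃; _×_; _,_; proj₁; proj₂)
open import Data.Product.Properties using (≡-dec)
import Data.Sum as Sum
open import Data.Sum using (_⊎_; inj₁; inj₂; [_,_]′)
open import Data.Rational
  using ( ℚ; 0ℚ; 1ℚ; _<_; _≤_; _+_; _*_; _-_; -_; _÷_; 1/_; _⊔_; _⊓_; mkℚ; toℚᵘ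
        ; positive; negative; nonNegative; nonPositive)
open import Data.Rational.Properties
import Data.Rational.Unnormalised as ℚᵘ
import Data.Rational.Unnormalised.Properties as ℚᵘ
open import Function.Bundles using (_⇔_; mk⇔; Equivalence)
open import Function.Definitions using (Injective)
open import Function.Properties.Equivalence using (⇔-setoid)
open import Relation.Nullary using (¬_; yes; no; contradiction)
open import Relation.Nullary.Decidable using (dec⇒maybe; from-yes; isYes; toWitness; fromWitness)
open import Relation.Binary.Core using (Rel)
open import Relation.Binary.Definitions using (Trichotomous; tri<; tri≈; tri>)
open import Relation.Binary.Structures using (IsStrictTotalOrder)
open import Relation.Binary.PropositionalEquality
open import Tactic.RingSolver using (solve-∀; solve)
open import Tactic.RingSolver.Core.AlmostCommutativeRing using (AlmostCommutativeRing; fromCommutativeRing)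

open import Defs

private variable a b c d : ℚ

ℚ-ring : AlmostCommutativeRing 0ℓ 0ℓ
ℚ-ring = fromCommutativeRing +-*-commutativeRing (λ x → dec⇒maybe (0ℚ ≟ x))

3ℚ 4ℚ : ℚ
3ℚ = 2ℚ + 1ℚ
4ℚ = 2ℚ + 2ℚ

0<1 : 0ℚ < 1ℚ
0<1 = from-yes (0ℚ <? 1ℚ)

0<2 : 0ℚ < 2ℚ
0<2 = from-yes (0ℚ <? 2ℚ)

0<3 : 0ℚ < 3ℚ
0<3 = from-yes (0ℚ <? 3ℚ)

0<4 : 0ℚ < 4ℚ
0<4 = from-yes (0ℚ <? 4ℚ)

<-by : ∀ {p q r} → 0ℚ < r → p + r ≡ q → p < q
<-by {p} {r = r} 0<r refl = begin-strict
  p       ≡⟨ +-identityʳ p ⟨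
  p + 0ℚ  <⟨ +-monoʳ-< p 0<r ⟩
  p + r   ∎
  where open ≤-Reasoning

≤-by : ∀ {p q r} → 0ℚ ≤ r → p + r ≡ q → p ≤ q
≤-by {p} {r = r} 0≤r refl = begin
  p       ≡⟨ +-identityʳ p ⟨
  p + 0ℚ  ≤⟨ +-monoʳ-≤ p 0≤r ⟩
  p + r   ∎
  where open ≤-Reasoning

p≤q⇒0≤q-p : ∀ {p q} → p ≤ q → 0ℚ ≤ q - p
p≤q⇒0≤q-p {p} {q} p≤q = subst (_≤ q - p) (+-inverseʳ p) (+-monoˡ-≤ (- p) p≤q)

p<q⇒0<q-p : ∀ {p q} → p < q → 0ℚ < q - p
p<q⇒0<q-p {p} {q} p<q = subst (_< q - p) (+-inverseʳ p) (+-monoˡ-< (- p) p<q)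

p<q⇒p-q<0 : ∀ {p q} → p < q → p - q < 0ℚ
p<q⇒p-q<0 {p} {q} p<q = subst (p - q <_) (+-inverseʳ q) (+-monoˡ-< (- q) p<q)

0<q-p⇒p<q : ∀ {p q} → 0ℚ < q - p → p < q
0<q-p⇒p<q {p} {q} 0<q-p = <-by 0<q-p (solve (p ∷ q ∷ []) ℚ-ring)

q-p<0⇒q<p : ∀ {p q} → q - p < 0ℚ → q < p
q-p<0⇒q<p {p} {q} q-p<0 = 0<q-p⇒p<q (begin-strict
  0ℚ         <⟨ neg-antimono-< q-p<0 ⟩
  - (q - p)  ≡⟨ solve (p ∷ q ∷ []) ℚ-ring ⟩
  p - q      ∎)
  where open ≤-Reasoning

0<p+q⇒-q<p : ∀ {p q} → 0ℚ < p + q → - q < p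
0<p+q⇒-q<p {p} {q} 0<p+q = <-by 0<p+q (solve (p ∷ q ∷ []) ℚ-ring)

-p<q⇒0<p+q : ∀ {p q} → - p < q → 0ℚ < p + q
-p<q⇒0<p+q {p} {q} -p<q = begin-strict
  0ℚ     ≡⟨ +-inverseʳ p ⟨
  p - p  <⟨ +-monoʳ-< p -p<q ⟩
  p + q  ∎
  where open ≤-Reasoning

p+r≤q⇒r≤q-p : ∀ {p q r} → p + r ≤ q → r ≤ q - p
p+r≤q⇒r≤q-p {p} {q} {r} p+r≤q = begin
  r          ≡⟨ cancel p r ⟨
  p + r - p  ≤⟨ +-monoˡ-≤ (- p) p+r≤q ⟩
  q - p      ∎
  where
  open ≤-Reasoning
  cancel : ∀ p r → p + r - p ≡ r
  cancel = solve-∀ ℚ-ring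

q-p≤q : ∀ {p q} → 0ℚ ≤ p → q - p ≤ q
q-p≤q {p} {q} 0≤p = ≤-by 0≤p (cancel p q)
  where
  cancel : ∀ p q → q - p + p ≡ q
  cancel = solve-∀ ℚ-ring

+-pos : ∀ {p q} → 0ℚ < p → 0ℚ < q → 0ℚ < p + q
+-pos = +-mono-<

*-pos : ∀ {p q} → 0ℚ < p → 0ℚ < q → 0ℚ < p * q
*-pos {p} {q} 0<p 0<q = positive⁻¹ _ {{pos*pos⇒pos p {{positive 0<p}} q {{positive 0<q}}}}

*-nonNeg : ∀ {p q} → 0ℚ ≤ p → 0ℚ ≤ q → 0ℚ ≤ p * q
*-nonNeg {p} {q} 0≤p 0≤q =
  nonNegative⁻¹ _ {{nonNeg*nonNeg⇒nonNeg p {{nonNegative 0≤p}} q {{nonNegative 0≤q}}}}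

*-cancelʳ-pos : ∀ {p r} → 0ℚ < r → 0ℚ < p * r → 0ℚ < p
*-cancelʳ-pos {p} {r} 0<r 0<pr =
  *-cancelʳ-<-nonNeg r {{nonNegative (<⇒≤ 0<r)}} (subst (_< p * r) (sym (*-zeroˡ r)) 0<pr)

*-cancelʳ-neg : ∀ {p r} → 0ℚ < r → p * r < 0ℚ → p < 0ℚ
*-cancelʳ-neg {p} {r} 0<r pr<0 =
  *-cancelʳ-<-nonNeg r {{nonNegative (<⇒≤ 0<r)}} (subst (p * r <_) (sym (*-zeroˡ r)) pr<0)

-p*-p≡p*p : ∀ p → - p * - p ≡ p * p
-p*-p≡p*p = solve-∀ ℚ-ring

0≤p*p : ∀ p → 0ℚ ≤ p * p
0≤p*p p with ≤-total 0ℚ p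
... | inj₁ 0≤p = *-nonNeg 0≤p 0≤p
... | inj₂ p≤0 = subst (0ℚ ≤_) (-p*-p≡p*p p) (*-nonNeg (neg-antimono-≤ p≤0) (neg-antimono-≤ p≤0))

*-self-mono-< : ∀ {p q} → 0ℚ ≤ p → p < q → p * p < q * q
*-self-mono-< {p} {q} 0≤p p<q = begin-strict
  p * p  ≤⟨ *-monoˡ-≤-nonNeg p {{nonNegative 0≤p}} (<⇒≤ p<q) ⟩
  p * q  <⟨ *-monoˡ-<-pos q {{positive (≤-<-trans 0≤p p<q)}} p<q ⟩
  q * q  ∎
  where open ≤-Reasoning

*-self-cancel-< : ∀ {p q} → 0ℚ ≤ q → p * p < q * q → p < q
*-self-cancel-< {p} {q} 0≤q p²<q² with <-cmp p q
... | tri< p<q _ _  = p<q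
... | tri≈ _ refl _ = contradiction p²<q² (<-irrefl refl)
... | tri> _ _ q<p  = contradiction p²<q² (<-asym (*-self-mono-< 0≤q q<p))

product-square : ∀ x w {v} → x * w ≡ v → (x * x) * (w * w) ≡ v * v
product-square x w refl = regroup x w
  where
  regroup : ∀ x w → (x * x) * (w * w) ≡ (x * w) * (x * w)
  regroup = solve-∀ ℚ-ring

∃-quotient : ∀ h {w} → 0ℚ < w → ∃ λ r → r * w ≡ h
∃-quotient h {w} 0<w = h ÷ w , (begin
  h * 1/ w * w    ≡⟨ *-assoc h _ w ⟩
  h * (1/ w * w)  ≡⟨ cong (h *_) (*-inverseˡ w) ⟩
  h * 1ℚ          ≡⟨ *-identityʳ h ⟩
  h               ∎)
  where
  open ≡-Reasoning
  instance _ = pos⇒nonZero w {{positive 0<w}}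

-- Irrationality of √2

2∣n*n⇒2∣n : ∀ n → 2 ∣ n ℕ.* n → 2 ∣ n
2∣n*n⇒2∣n n 2∣n² with euclidsLemma n n (from-yes (prime? 2)) 2∣n²
... | inj₁ 2∣n = 2∣n
... | inj₂ 2∣n = 2∣n

x²≡2y²⇒halve : ∀ x y → x ℕ.* x ≡ 2 ℕ.* (y ℕ.* y) →
               ∃ λ x′ → x ≡ x′ ℕ.* 2 × y ℕ.* y ≡ 2 ℕ.* (x′ ℕ.* x′)
x²≡2y²⇒halve x y eq
  with divides x′ refl ← 2∣n*n⇒2∣n x (divides (y ℕ.* y) (trans eq (ℕ.*-comm 2 (y ℕ.* y))))
  = x′ , refl , ℕ.*-cancelˡ-≡ _ _ 2 (trans (sym eq) (square-double x′))
  where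
  square-double : ∀ a → (a ℕ.* 2) ℕ.* (a ℕ.* 2) ≡ 2 ℕ.* (2 ℕ.* (a ℕ.* a))
  square-double = ℕ-Solver.solve-∀

-- Infinite descent: a solution (x , y) yields the smaller solution (x/2 , y/2).
x²≡2y²⇒y≡0 : ∀ x y → x ℕ.* x ≡ 2 ℕ.* (y ℕ.* y) → y ≡ 0
x²≡2y²⇒y≡0 x y = <-rec (λ y → ∀ x → x ℕ.* x ≡ 2 ℕ.* (y ℕ.* y) → y ≡ 0) descend y x
  where
  descend : ∀ y → (∀ {z} → z ℕ.< y → ∀ x → x ℕ.* x ≡ 2 ℕ.* (z ℕ.* z) → z ≡ 0) →
            ∀ x → x ℕ.* x ≡ 2 ℕ.* (y ℕ.* y) → y ≡ 0
  descend y ih x eq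
    with x′ , refl , eq′ ← x²≡2y²⇒halve x y eq
    with y′ , y≡2y′ , eq″ ← x²≡2y²⇒halve y x′ eq′
    = trans y≡2y′ (cong (ℕ._* 2) (y′≡0 y′ y≡2y′ eq″))
    where
    y′≡0 : ∀ y′ → y ≡ y′ ℕ.* 2 → x′ ℕ.* x′ ≡ 2 ℕ.* (y′ ℕ.* y′) → y′ ≡ 0
    y′≡0 zero       _     _   = refl
    y′≡0 y′@(suc _) y≡2y′ eq″ =
      ih (subst (y′ ℕ.<_) (sym y≡2y′) (ℕ.m<m*n y′ 2 (ℕ.s≤s (ℕ.s≤s ℕ.z≤n)))) x′ eq″

-- Clearing denominators, a = m/D and b = n/E give (|m| E)² = 2 (|n| D)².
a²≡2b²⇒b≡0 : ∀ a b → a * a ≡ 2ℚ * (b * b) → b ≡ 0ℚ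
a²≡2b²⇒b≡0 a@(mkℚ m d-1 _) b@(mkℚ n e-1 _) eq =
  ↥p≡0⇒p≡0 b (ℤ.∣i∣≡0⇒i≡0 (ℕ.m*n≡0⇒m≡0 N D (x²≡2y²⇒y≡0 (M ℕ.* E) (N ℕ.* D) in-ℕ)))
  where
  open ≡-Reasoning
  M N D E : ℕ
  M = ℤ.∣ m ∣
  N = ℤ.∣ n ∣
  D = suc d-1
  E = suc e-1
  in-ℚᵘ : toℚᵘ a ℚᵘ.* toℚᵘ a ℚᵘ.≃ toℚᵘ 2ℚ ℚᵘ.* (toℚᵘ b ℚᵘ.* toℚᵘ b)
  in-ℚᵘ = ℚᵘ.≃-trans (ℚᵘ.≃-sym (toℚᵘ-homo-* a a)) (ℚᵘ.≃-trans (toℚᵘ-cong eq)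
            (ℚᵘ.≃-trans (toℚᵘ-homo-* 2ℚ (b * b)) (ℚᵘ.*-congˡ {toℚᵘ 2ℚ} (toℚᵘ-homo-* b b))))
  in-ℕ : (M ℕ.* E) ℕ.* (M ℕ.* E) ≡ 2 ℕ.* ((N ℕ.* D) ℕ.* (N ℕ.* D))
  in-ℕ = begin
    (M ℕ.* E) ℕ.* (M ℕ.* E)                         ≡⟨ regroup M E ⟩
    (M ℕ.* M) ℕ.* (1 ℕ.* (E ℕ.* E))                 ≡⟨ ∣ij∣*k m m _ ⟨
    ℤ.∣ (m ℤ.* m) ℤ.* ℤ.+ (1 ℕ.* (E ℕ.* E)) ∣        ≡⟨ cong ℤ.∣_∣ (ℚᵘ.drop-*≡* in-ℚᵘ) ⟩
    ℤ.∣ (ℤ.+ 2 ℤ.* (n ℤ.* n)) ℤ.* ℤ.+ (D ℕ.* D) ∣    ≡⟨ ∣ij∣*k (ℤ.+ 2) (n ℤ.* n) _ ⟩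
    (2 ℕ.* ℤ.∣ n ℤ.* n ∣) ℕ.* (D ℕ.* D)             ≡⟨ cong (λ k → (2 ℕ.* k) ℕ.* (D ℕ.* D)) (ℤ.abs-* n n) ⟩
    (2 ℕ.* (N ℕ.* N)) ℕ.* (D ℕ.* D)                 ≡⟨ regroup′ N D ⟩
    2 ℕ.* ((N ℕ.* D) ℕ.* (N ℕ.* D))                 ∎
    where
    ∣ij∣*k : ∀ i j k → ℤ.∣ (i ℤ.* j) ℤ.* ℤ.+ k ∣ ≡ (ℤ.∣ i ∣ ℕ.* ℤ.∣ j ∣) ℕ.* k
    ∣ij∣*k i j k = trans (ℤ.abs-* (i ℤ.* j) (ℤ.+ k)) (cong (ℕ._* k) (ℤ.abs-* i j))
    regroup : ∀ a b → (a ℕ.* b) ℕ.* (a ℕ.* b) ≡ (a ℕ.* a) ℕ.* (1 ℕ.* (b ℕ.* b))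
    regroup = ℕ-Solver.solve-∀
    regroup′ : ∀ a b → (2 ℕ.* (a ℕ.* a)) ℕ.* (b ℕ.* b) ≡ 2 ℕ.* ((a ℕ.* b) ℕ.* (a ℕ.* b))
    regroup′ = ℕ-Solver.solve-∀

-- Positivity in ℚ(√2)

pell-norm : ∀ x y → (3ℚ * x + 4ℚ * y) * (3ℚ * x + 4ℚ * y) - 2ℚ * ((2ℚ * x + 3ℚ * y) * (2ℚ * x + 3ℚ * y))
                  ≡ x * x - 2ℚ * (y * y)
pell-norm = solve-∀ ℚ-ring

pell-cross : ∀ x y → x * (2ℚ * x + 3ℚ * y) - y * (3ℚ * x + 4ℚ * y) ≡ 2ℚ * (x * x - 2ℚ * (y * y))
pell-cross = solve-∀ ℚ-ring

-- The witness is r = (3x + 4y)/(2x + 3y), one step of the Pell iteration applied to x/y.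
√2-between : ∀ {x y} → 0ℚ < x → 0ℚ < y → Σ ℚ λ r → 0ℚ < r
  × (2ℚ * (y * y) < x * x → 2ℚ < r * r × y * r < x)
  × (x * x < 2ℚ * (y * y) → r * r < 2ℚ × x < y * r)
√2-between {x} {y} 0<x 0<y = r , 0<r , above , below
  where
  open ≡-Reasoning
  x′ y′ N : ℚ
  x′ = 3ℚ * x + 4ℚ * y
  y′ = 2ℚ * x + 3ℚ * y
  N = x * x - 2ℚ * (y * y)
  0<y′ : 0ℚ < y′
  0<y′ = +-pos (*-pos 0<2 0<x) (*-pos 0<3 0<y)
  0<y′² : 0ℚ < y′ * y′
  0<y′² = *-pos 0<y′ 0<y′
  r : ℚ
  r = proj₁ (∃-quotient x′ 0<y′)
  ry′≡x′ : r * y′ ≡ x′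
  ry′≡x′ = proj₂ (∃-quotient x′ 0<y′)
  0<r : 0ℚ < r
  0<r = *-cancelʳ-pos 0<y′ (subst (0ℚ <_) (sym ry′≡x′) (+-pos (*-pos 0<3 0<x) (*-pos 0<4 0<y)))
  square : (r * r - 2ℚ) * (y′ * y′) ≡ N
  square = begin
    (r * r - 2ℚ) * (y′ * y′)              ≡⟨ regroup r y′ ⟩
    (r * y′) * (r * y′) - 2ℚ * (y′ * y′)  ≡⟨ cong (λ z → z * z - 2ℚ * (y′ * y′)) ry′≡x′ ⟩
    x′ * x′ - 2ℚ * (y′ * y′)              ≡⟨ pell-norm x y ⟩
    N                                     ∎
    where
    regroup : ∀ r w → (r * r - 2ℚ) * (w * w) ≡ (r * w) * (r * w) - 2ℚ * (w * w)
    regroup = solve-∀ ℚ-ring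
  cross : (x - y * r) * y′ ≡ 2ℚ * N
  cross = begin
    (x - y * r) * y′       ≡⟨ regroup x y r y′ ⟩
    x * y′ - y * (r * y′)  ≡⟨ cong (λ z → x * y′ - y * z) ry′≡x′ ⟩
    x * y′ - y * x′        ≡⟨ pell-cross x y ⟩
    2ℚ * N                 ∎
    where
    regroup : ∀ x y r w → (x - y * r) * w ≡ x * w - y * (r * w)
    regroup = solve-∀ ℚ-ring
  above : 2ℚ * (y * y) < x * x → 2ℚ < r * r × y * r < x
  above 2y²<x² =
      0<q-p⇒p<q (*-cancelʳ-pos 0<y′² (subst (0ℚ <_) (sym square) 0<N))
    , 0<q-p⇒p<q (*-cancelʳ-pos 0<y′ (subst (0ℚ <_) (sym cross) (*-pos 0<2 0<N)))
    where
    0<N : 0ℚ < N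
    0<N = p<q⇒0<q-p 2y²<x²
  below : x * x < 2ℚ * (y * y) → r * r < 2ℚ × x < y * r
  below x²<2y² =
      q-p<0⇒q<p (*-cancelʳ-neg 0<y′² (subst (_< 0ℚ) (sym square) N<0))
    , q-p<0⇒q<p (*-cancelʳ-neg 0<y′ (subst (_< 0ℚ) (sym cross) (*-monoʳ-<-pos 2ℚ {{positive 0<2}} N<0)))
    where
    N<0 : N < 0ℚ
    N<0 = p<q⇒p-q<0 x²<2y²

record Bracket : Set where
  constructor bracket
  field
    lo hi : ℚ
    lo²<2 : lo * lo < 2ℚ
    0<hi  : 0ℚ < hi
    2<hi² : 2ℚ < hi * hi

open Bracket

lo≤hi : ∀ I J → lo I ≤ hi J
lo≤hi I J = <⇒≤ (*-self-cancel-< (<⇒≤ (0<hi J)) (<-trans (lo²<2 I) (2<hi² J)))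

subst-either : ∀ (P : ℚ → Set) {p q r} → r ≡ p ⊎ r ≡ q → P p → P q → P r
subst-either P (inj₁ refl) Pp _  = Pp
subst-either P (inj₂ refl) _  Pq = Pq

_∩_ : Bracket → Bracket → Bracket
I ∩ J = record
  { lo    = lo I ⊔ lo J
  ; hi    = hi I ⊓ hi J
  ; lo²<2 = subst-either (λ t → t * t < 2ℚ) (⊔-sel (lo I) (lo J)) (lo²<2 I) (lo²<2 J)
  ; 0<hi  = subst-either (0ℚ <_) (⊓-sel (hi I) (hi J)) (0<hi I) (0<hi J)
  ; 2<hi² = subst-either (λ t → 2ℚ < t * t) (⊓-sel (hi I) (hi J)) (2<hi² I) (2<hi² J)
  }

unit-bracket : Bracket
unit-bracket = bracket 1ℚ 2ℚ (from-yes (1ℚ * 1ℚ <? 2ℚ)) 0<2 (from-yes (2ℚ <? 2ℚ * 2ℚ))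

record PositiveOn (a b : ℚ) (I : Bracket) : Set where
  constructor _,_
  field
    at-lo : 0ℚ < a + b * lo I
    at-hi : 0ℚ < a + b * hi I

affine-pos-between : ∀ {s t u} → 0ℚ < a + b * s → 0ℚ < a + b * t → s ≤ u → u ≤ t → 0ℚ < a + b * u
affine-pos-between {a} {b} at-s at-t s≤u u≤t with ≤-total 0ℚ b
... | inj₁ 0≤b = <-≤-trans at-s (+-monoʳ-≤ a (*-monoˡ-≤-nonNeg b {{nonNegative 0≤b}} s≤u))
... | inj₂ b≤0 = <-≤-trans at-t (+-monoʳ-≤ a (*-monoˡ-≤-nonPos b {{nonPositive b≤0}} u≤t))

PositiveOn-shrink : ∀ {I} K → lo I ≤ lo K → hi K ≤ hi I → PositiveOn a b I → PositiveOn a b K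
PositiveOn-shrink {a} {b} {I} K lo≤ ≤hi (at-lo , at-hi) = between lo≤ (lo≤hi K I) , between (lo≤hi I K) ≤hi
  where
  between : ∀ {u} → lo I ≤ u → u ≤ hi I → 0ℚ < a + b * u
  between = affine-pos-between {a} {b} at-lo at-hi

PositiveOn-+ : ∀ {I} → PositiveOn a b I → PositiveOn c d I → PositiveOn (a + c) (b + d) I
PositiveOn-+ {a} {b} {c} {d} {I} (ab-lo , ab-hi) (cd-lo , cd-hi) =
  subst (0ℚ <_) (affine-+ (lo I)) (+-pos ab-lo cd-lo) , subst (0ℚ <_) (affine-+ (hi I)) (+-pos ab-hi cd-hi)
  where
  affine-+ : ∀ t → (a + b * t) + (c + d * t) ≡ (a + c) + (b + d) * t
  affine-+ t = solve (a ∷ b ∷ c ∷ d ∷ t ∷ []) ℚ-ring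

nonNeg∧≢0⇒pos⊎pos : 0ℚ ≤ a → 0ℚ ≤ b → ¬ (a ≡ 0ℚ × b ≡ 0ℚ) → 0ℚ < a ⊎ 0ℚ < b
nonNeg∧≢0⇒pos⊎pos {a} {b} 0≤a 0≤b ≢0 with <-cmp 0ℚ a | <-cmp 0ℚ b
... | tri< 0<a _ _ | _            = inj₁ 0<a
... | _            | tri< 0<b _ _ = inj₂ 0<b
... | tri≈ _ 0≡a _ | tri≈ _ 0≡b _ = contradiction (sym 0≡a , sym 0≡b) ≢0
... | tri> _ _ a<0 | _            = contradiction (≤-<-trans 0≤a a<0) (<-irrefl refl)
... | _            | tri> _ _ b<0 = contradiction (≤-<-trans 0≤b b<0) (<-irrefl refl)

Pos√2⇒PositiveOn : Pos√2 a b → Σ Bracket (PositiveOn a b)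
Pos√2⇒PositiveOn {a} {b} (inj₁ (0≤a , 0≤b , ≢0)) = unit-bracket , at 0<1 , at 0<2
  where
  at : ∀ {t} → 0ℚ < t → 0ℚ < a + b * t
  at 0<t with nonNeg∧≢0⇒pos⊎pos 0≤a 0≤b ≢0
  ... | inj₁ 0<a = +-mono-<-≤ 0<a (*-nonNeg 0≤b (<⇒≤ 0<t))
  ... | inj₂ 0<b = +-mono-≤-< 0≤a (*-pos 0<b 0<t)
Pos√2⇒PositiveOn {a} {b} (inj₂ (inj₁ (0<a , b<0 , 2b²<a²))) =
  let r , 0<r , above , _ = √2-between 0<a (neg-antimono-< b<0)
      2<r² , -b*r<a = above (subst (λ z → 2ℚ * z < a * a) (sym (-p*-p≡p*p b)) 2b²<a²)
  in bracket 0ℚ r (from-yes (0ℚ * 0ℚ <? 2ℚ)) 0<r 2<r²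
   , subst (0ℚ <_) (sym (a+b*0≡a a b)) 0<a
   , subst (0ℚ <_) (+-comm (b * r) a) (-p<q⇒0<p+q (subst (_< a) (sym (neg-distribˡ-* b r)) -b*r<a))
  where
  a+b*0≡a : ∀ a b → a + b * 0ℚ ≡ a
  a+b*0≡a = solve-∀ ℚ-ring
Pos√2⇒PositiveOn {a} {b} (inj₂ (inj₂ (a<0 , 0<b , a²<2b²))) =
  let r , _ , _ , below = √2-between (neg-antimono-< a<0) 0<b
      r²<2 , -a<b*r = below (subst (_< 2ℚ * (b * b)) (sym (-p*-p≡p*p a)) a²<2b²)
      I : Bracket
      I = bracket r 2ℚ r²<2 0<2 (from-yes (2ℚ <? 2ℚ * 2ℚ))
      at-r : 0ℚ < a + b * r
      at-r = -p<q⇒0<p+q -a<b*r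
  in I , at-r , <-≤-trans at-r (+-monoʳ-≤ a (*-monoˡ-≤-nonNeg b {{nonNegative (<⇒≤ 0<b)}} (lo≤hi I I)))

PositiveOn⇒Pos√2 : ∀ I → PositiveOn a b I → Pos√2 a b
PositiveOn⇒Pos√2 {a} {b} I (at-lo , at-hi) with <-cmp b 0ℚ
... | tri< b<0 _ _ = inj₂ (inj₁ (0<a , b<0 , 2b²<a²))
  where
  open ≤-Reasoning
  -b*hi<a : - b * hi I < a
  -b*hi<a = subst (_< a) (neg-distribˡ-* b (hi I)) (0<p+q⇒-q<p at-hi)
  0<-b*hi : 0ℚ < - b * hi I
  0<-b*hi = *-pos (neg-antimono-< b<0) (0<hi I)
  0<a : 0ℚ < a
  0<a = <-trans 0<-b*hi -b*hi<a
  2b²<a² : 2ℚ * (b * b) < a * a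
  2b²<a² = begin-strict
    2ℚ * (b * b)                 ≡⟨ *-comm 2ℚ (b * b) ⟩
    (b * b) * 2ℚ                 <⟨ *-monoʳ-<-pos (b * b) {{neg*neg⇒pos b {{negative b<0}} b {{negative b<0}}}} (2<hi² I) ⟩
    (b * b) * (hi I * hi I)      ≡⟨ regroup b (hi I) ⟩
    (- b * hi I) * (- b * hi I)  <⟨ *-self-mono-< (<⇒≤ 0<-b*hi) -b*hi<a ⟩
    a * a                        ∎
    where
    regroup : ∀ b h → (b * b) * (h * h) ≡ (- b * h) * (- b * h)
    regroup = solve-∀ ℚ-ring
... | tri≈ _ b≡0 _ = inj₁ (<⇒≤ 0<a , ≤-reflexive (sym b≡0) , λ (a≡0 , _) → <-irrefl (sym a≡0) 0<a)
  where
  a+0*t≡a : ∀ a t → a + 0ℚ * t ≡ a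
  a+0*t≡a = solve-∀ ℚ-ring
  0<a : 0ℚ < a
  0<a = subst (0ℚ <_) (a+0*t≡a a (lo I)) (subst (λ z → 0ℚ < a + z * lo I) b≡0 at-lo)
... | tri> _ _ 0<b with a <? 0ℚ
...   | no a≮0  = inj₁ (≮⇒≥ a≮0 , <⇒≤ 0<b , λ (_ , b≡0) → <-irrefl (sym b≡0) 0<b)
...   | yes a<0 = inj₂ (inj₂ (a<0 , 0<b , a²<2b²))
  where
  open ≤-Reasoning
  -a<b*lo : - a < b * lo I
  -a<b*lo = 0<p+q⇒-q<p (subst (0ℚ <_) (+-comm a (b * lo I)) at-lo)
  a²<2b² : a * a < 2ℚ * (b * b)
  a²<2b² = begin-strict
    a * a                    ≡⟨ -p*-p≡p*p a ⟨
    - a * - a                <⟨ *-self-mono-< (<⇒≤ (neg-antimono-< a<0)) -a<b*lo ⟩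
    (b * lo I) * (b * lo I)  ≡⟨ regroup b (lo I) ⟩
    (b * b) * (lo I * lo I)  <⟨ *-monoʳ-<-pos (b * b) {{pos*pos⇒pos b {{positive 0<b}} b {{positive 0<b}}}} (lo²<2 I) ⟩
    (b * b) * 2ℚ             ≡⟨ *-comm (b * b) 2ℚ ⟩
    2ℚ * (b * b)             ∎
    where
    regroup : ∀ b l → (b * l) * (b * l) ≡ (b * b) * (l * l)
    regroup = solve-∀ ℚ-ring

Pos√2-+ : Pos√2 a b → Pos√2 c d → Pos√2 (a + c) (b + d)
Pos√2-+ pos₁ pos₂ =
  let I , on-I = Pos√2⇒PositiveOn pos₁
      J , on-J = Pos√2⇒PositiveOn pos₂
  in PositiveOn⇒Pos√2 (I ∩ J) (PositiveOn-+
       (PositiveOn-shrink (I ∩ J) (p≤p⊔q (lo I) (lo J)) (p⊓q≤p (hi I) (hi J)) on-I)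
       (PositiveOn-shrink (I ∩ J) (p≤q⊔p (lo I) (lo J)) (p⊓q≤q (hi I) (hi J)) on-J))

¬Pos√2-0 : ¬ Pos√2 0ℚ 0ℚ
¬Pos√2-0 (inj₁ (_ , _ , ≢0))      = ≢0 (refl , refl)
¬Pos√2-0 (inj₂ (inj₁ (0<0 , _))) = <-irrefl refl 0<0
¬Pos√2-0 (inj₂ (inj₂ (0<0 , _))) = <-irrefl refl 0<0

Pos√2-asym : Pos√2 a b → ¬ Pos√2 (- a) (- b)
Pos√2-asym {a} {b} pos neg = ¬Pos√2-0 (subst₂ Pos√2 (+-inverseʳ a) (+-inverseʳ b) (Pos√2-+ pos neg))

Pos√2-nonNeg : 0ℚ ≤ a → 0ℚ ≤ b → 0ℚ < a ⊎ 0ℚ < b → Pos√2 a b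
Pos√2-nonNeg 0≤a 0≤b pos = inj₁ (0≤a , 0≤b , λ (a≡0 , b≡0) → [ <-irrefl (sym a≡0) , <-irrefl (sym b≡0) ]′ pos)

Pos√2-opposite-signs : a < 0ℚ → 0ℚ < b → Pos√2 a b ⊎ Pos√2 (- a) (- b)
Pos√2-opposite-signs {a} {b} a<0 0<b with <-cmp (a * a) (2ℚ * (b * b))
... | tri< a²<2b² _ _ = inj₁ (inj₂ (inj₂ (a<0 , 0<b , a²<2b²)))
... | tri≈ _ a²≡2b² _ = contradiction (a²≡2b²⇒b≡0 a b a²≡2b²) (λ b≡0 → <-irrefl (sym b≡0) 0<b)
... | tri> _ _ 2b²<a² = inj₂ (inj₂ (inj₁ (neg-antimono-< a<0 , neg-antimono-< 0<b ,
  subst₂ _<_ (cong (2ℚ *_) (sym (-p*-p≡p*p b))) (sym (-p*-p≡p*p a)) 2b²<a²)))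

Pos√2-total : ¬ (a ≡ 0ℚ × b ≡ 0ℚ) → Pos√2 a b ⊎ Pos√2 (- a) (- b)
Pos√2-total {a} {b} ≢0 with <-cmp 0ℚ a | <-cmp 0ℚ b
... | tri< 0<a _ _ | tri< 0<b _ _ = inj₁ (Pos√2-nonNeg (<⇒≤ 0<a) (<⇒≤ 0<b) (inj₁ 0<a))
... | tri< 0<a _ _ | tri≈ _ 0≡b _ = inj₁ (Pos√2-nonNeg (<⇒≤ 0<a) (≤-reflexive 0≡b) (inj₁ 0<a))
... | tri≈ _ 0≡a _ | tri< 0<b _ _ = inj₁ (Pos√2-nonNeg (≤-reflexive 0≡a) (<⇒≤ 0<b) (inj₂ 0<b))
... | tri> _ _ a<0 | tri> _ _ b<0 =
  inj₂ (Pos√2-nonNeg (<⇒≤ (neg-antimono-< a<0)) (<⇒≤ (neg-antimono-< b<0)) (inj₁ (neg-antimono-< a<0)))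
... | tri> _ _ a<0 | tri≈ _ 0≡b _ =
  inj₂ (Pos√2-nonNeg (<⇒≤ (neg-antimono-< a<0)) (≤-reflexive (cong -_ 0≡b)) (inj₁ (neg-antimono-< a<0)))
... | tri≈ _ 0≡a _ | tri> _ _ b<0 =
  inj₂ (Pos√2-nonNeg (≤-reflexive (cong -_ 0≡a)) (<⇒≤ (neg-antimono-< b<0)) (inj₂ (neg-antimono-< b<0)))
... | tri≈ _ 0≡a _ | tri≈ _ 0≡b _ = contradiction (sym 0≡a , sym 0≡b) ≢0
... | tri> _ _ a<0 | tri< 0<b _ _ = Pos√2-opposite-signs a<0 0<b
... | tri< 0<a _ _ | tri> _ _ b<0 =
  Sum.swap (subst₂ (λ a′ b′ → Pos√2 (- a) (- b) ⊎ Pos√2 a′ b′) (neg-involutive a) (neg-involutive b)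
    (Pos√2-opposite-signs (neg-antimono-< 0<a) (neg-antimono-< b<0)))
  where
  neg-involutive : ∀ p → - - p ≡ p
  neg-involutive = solve-∀ ℚ-ring

infix 4 _≺_

-- P ≺ Q compares the u-coordinates; the w-coordinates are compared by conj P ≺ conj Q.
_≺_ : V → V → Set
(q , r) ≺ (s , t) = q + r √2< s + t √2

conj : V → V
conj (q , r) = q , - r

≺-trans : ∀ {P Q R} → P ≺ Q → Q ≺ R → P ≺ R
≺-trans {q , r} {s , t} {u , v} P≺Q Q≺R = subst₂ Pos√2 (telescope q s u) (telescope r t v) (Pos√2-+ P≺Q Q≺R)
  where
  telescope : ∀ x y z → (y - x) + (z - y) ≡ z - x
  telescope = solve-∀ ℚ-ring

≺-irrefl : ∀ {P} → ¬ P ≺ P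
≺-irrefl {q , r} P≺P = ¬Pos√2-0 (subst₂ Pos√2 (+-inverseʳ q) (+-inverseʳ r) P≺P)

≺-asym : ∀ {P Q} → P ≺ Q → ¬ Q ≺ P
≺-asym {q , r} {s , t} P≺Q Q≺P = Pos√2-asym P≺Q (subst₂ Pos√2 (flip-sub s q) (flip-sub t r) Q≺P)
  where
  flip-sub : ∀ x y → y - x ≡ - (x - y)
  flip-sub = solve-∀ ℚ-ring

≺-total : ∀ {P Q} → P ≢ Q → P ≺ Q ⊎ Q ≺ P
≺-total {q , r} {s , t} P≢Q = Sum.map₂ (subst₂ Pos√2 (neg-sub s q) (neg-sub t r))
  (Pos√2-total {s - q} {t - r} λ (s-q≡0 , t-r≡0) → P≢Q (cong₂ _,_ (sub≡0 s q s-q≡0) (sub≡0 t r t-r≡0)))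
  where
  open ≡-Reasoning
  neg-sub : ∀ x y → - (x - y) ≡ y - x
  neg-sub = solve-∀ ℚ-ring
  cancel : ∀ x y → y + (x - y) ≡ x
  cancel = solve-∀ ℚ-ring
  sub≡0 : ∀ x y → x - y ≡ 0ℚ → y ≡ x
  sub≡0 x y x-y≡0 = begin
    y            ≡⟨ +-identityʳ y ⟨
    y + 0ℚ       ≡⟨ cong (y +_) x-y≡0 ⟨
    y + (x - y)  ≡⟨ cancel x y ⟩
    x            ∎

≺-compare : Trichotomous _≡_ _≺_
≺-compare P Q with ≡-dec _≟_ _≟_ P Q
... | yes refl = tri≈ (≺-irrefl {P}) refl (≺-irrefl {P})
... | no P≢Q   = [ (λ P≺Q → tri< P≺Q P≢Q (≺-asym {P} {Q} P≺Q))
                 , (λ Q≺P → tri> (≺-asym {Q} {P} Q≺P) P≢Q Q≺P)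
                 ]′ (≺-total {P} {Q} P≢Q)

≺-isStrictTotalOrder : IsStrictTotalOrder _≡_ _≺_
≺-isStrictTotalOrder = record
  { isStrictPartialOrder = record
    { isEquivalence = isEquivalence
    ; irrefl        = λ { {P} refl → ≺-irrefl {P} }
    ; trans         = λ {P} {Q} {R} → ≺-trans {P} {Q} {R}
    ; <-resp-≈      = resp₂ _≺_
    }
  ; compare = ≺-compare
  }

≺⇒≢ : ∀ {P Q} → P ≺ Q → P ≢ Q
≺⇒≢ {P} P≺Q refl = ≺-irrefl {P} P≺Q

conj-injective : ∀ {P Q} → conj P ≡ conj Q → P ≡ Q
conj-injective {q , r} {s , t} eq = cong₂ _,_ (cong proj₁ eq) (neg-injective (cong proj₂ eq))

≢⇒components-≢ : ∀ {P Q : V} → P ≢ Q → proj₁ P ≢ proj₁ Q ⊎ proj₂ P ≢ proj₂ Q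
≢⇒components-≢ {q , r} {s , t} P≢Q with q ≟ s
... | yes refl = inj₂ λ r≡t → P≢Q (cong (q ,_) r≡t)
... | no q≢s   = inj₁ q≢s

URAdj-sym : ∀ {P Q} → URAdj P Q → URAdj Q P
URAdj-sym (P≢Q , edge) = Sum.map ≢-sym ≢-sym P≢Q , Sum.swap edge

URAdj⇔conj-≺ : ∀ {P Q} → P ≺ Q → URAdj P Q ⇔ conj P ≺ conj Q
URAdj⇔conj-≺ {P} {Q} P≺Q = mk⇔ to λ c → ≢⇒components-≢ (≺⇒≢ {P} {Q} P≺Q) , inj₁ (P≺Q , c)
  where
  to : URAdj P Q → conj P ≺ conj Q
  to (_ , inj₁ (_ , c))   = c
  to (_ , inj₂ (Q≺P , _)) = contradiction Q≺P (≺-asym {P} {Q} P≺Q)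

-- Ranking an injective family in a strict total order

injective⇒surjective : ∀ {n} (f : Fin n → Fin n) → Injective _≡_ _≡_ f → ∀ y → ∃ λ x → f x ≡ y
injective⇒surjective {suc n} f f-inj y with any? (λ x → f x ≟ᶠ y)
... | yes found = found
... | no ¬found = contradiction (injective⇒≤ g-inj) ℕ.1+n≰n
  where
  y≢f : ∀ x → y ≢ f x
  y≢f x y≡fx = ¬found (x , sym y≡fx)
  g : Fin (suc n) → Fin n
  g x = punchOut (y≢f x)
  g-inj : Injective _≡_ _≡_ g
  g-inj eq = f-inj (punchOut-injective (y≢f _) (y≢f _) eq)

injective⇒permutation : ∀ {n} (f : Fin n → Fin n) → Injective _≡_ _≡_ f → Permutation′ n
injective⇒permutation f f-inj = permutation f (λ y → proj₁ (f⁻¹ y))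
  (λ y → proj₂ (f⁻¹ y)) (λ x → f-inj (proj₂ (f⁻¹ (f x))))
  where
  f⁻¹ : ∀ y → ∃ λ x → f x ≡ y
  f⁻¹ = injective⇒surjective f f-inj

module _ {a ℓ} {A : Set a} {_⊏_ : Rel A ℓ} (sto : IsStrictTotalOrder _≡_ _⊏_)
         {n} (f : Fin n → A) (f-inj : Injective _≡_ _≡_ f) where

  open IsStrictTotalOrder sto using (compare; irrefl) renaming (trans to ⊏-trans; _<?_ to _⊏?_)

  below : Fin n → Subset n
  below j = tabulate λ i → isYes (f i ⊏? f j)

  ∈-below : ∀ {i j} → i ∈ below j ⇔ f i ⊏ f j
  ∈-below {i} {j} = mk⇔
    (λ i∈ → toWitness {a? = f i ⊏? f j} (Equivalence.from T-≡ (trans (sym (lookup∘tabulate _ i)) ([]=⇒lookup i∈))))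
    (λ fi<fj → lookup⇒[]= i _ (trans (lookup∘tabulate _ i) (Equivalence.to T-≡ (fromWitness {a? = f i ⊏? f j} fi<fj))))

  ∉-below-self : ∀ {j} → ¬ j ∈ below j
  ∉-below-self j∈ = irrefl refl (Equivalence.to ∈-below j∈)

  below-⊂ : ∀ {i j} → f i ⊏ f j → below i ⊂ below j
  below-⊂ fi<fj = (λ k∈ → Equivalence.from ∈-below (⊏-trans (Equivalence.to ∈-below k∈) fi<fj))
                , _ , Equivalence.from ∈-below fi<fj , ∉-below-self

  ∣below∣<n : ∀ j → ∣ below j ∣ ℕ.< n
  ∣below∣<n j = subst (∣ below j ∣ ℕ.<_) (∣⊤∣≡n n) (p⊂q⇒∣p∣<∣q∣ (⊆⊤ , j , ∈⊤ , ∉-below-self))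

  rank : Fin n → Fin n
  rank j = fromℕ< (∣below∣<n j)

  rank-mono : ∀ {i j} → f i ⊏ f j → rank i <ᶠ rank j
  rank-mono {i} {j} fi<fj = subst₂ ℕ._<_ (sym (toℕ-fromℕ< (∣below∣<n i))) (sym (toℕ-fromℕ< (∣below∣<n j)))
    (p⊂q⇒∣p∣<∣q∣ (below-⊂ fi<fj))

  rank-reflects : ∀ {i j} → rank i <ᶠ rank j → f i ⊏ f j
  rank-reflects {i} {j} ri<rj with compare (f i) (f j)
  ... | tri< fi<fj _ _ = fi<fj
  ... | tri≈ _ fi≡fj _ = contradiction (subst (λ k → rank i <ᶠ rank k) (sym (f-inj fi≡fj)) ri<rj) (ℕ.<-irrefl refl)
  ... | tri> _ _ fj<fi = contradiction (rank-mono fj<fi) (ℕ.<-asym ri<rj)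

  rank-injective : Injective _≡_ _≡_ rank
  rank-injective {i} {j} ri≡rj with compare (f i) (f j)
  ... | tri< fi<fj _ _ = contradiction (rank-mono fi<fj) (ℕ.<-irrefl (cong toℕ ri≡rj))
  ... | tri≈ _ fi≡fj _ = f-inj fi≡fj
  ... | tri> _ _ fj<fi = contradiction (rank-mono fj<fi) (ℕ.<-irrefl (cong toℕ (sym ri≡rj)))

  rank-permutation : Σ (Permutation′ n) λ ρ → ∀ i j → f i ⊏ f j ⇔ ρ ⟨$⟩ʳ i <ᶠ ρ ⟨$⟩ʳ j
  rank-permutation = injective⇒permutation rank rank-injective , λ i j → mk⇔ rank-mono rank-reflects

induced⇒permutation : ∀ H → IsInducedSubgraphOfUR H → IsPermutationGraph H
induced⇒permutation H (f , f-inj , f-adj) = π , π ∘ₚ ρ′ , adjacency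
  where
  open FinGraph H using (n; E)
  open import Relation.Binary.Reasoning.Setoid (⇔-setoid 0ℓ)
  by-u : Σ (Permutation′ n) λ ρ → ∀ k l → f k ≺ f l ⇔ ρ ⟨$⟩ʳ k <ᶠ ρ ⟨$⟩ʳ l
  by-u = rank-permutation ≺-isStrictTotalOrder f f-inj
  by-w : Σ (Permutation′ n) λ ρ → ∀ k l → conj (f k) ≺ conj (f l) ⇔ ρ ⟨$⟩ʳ k <ᶠ ρ ⟨$⟩ʳ l
  by-w = rank-permutation ≺-isStrictTotalOrder (λ k → conj (f k)) (λ eq → f-inj (conj-injective eq))
  ρ ρ′ π : Permutation′ n
  ρ  = proj₁ by-u
  ρ′ = proj₁ by-w
  π  = flip ρ
  adjacency : ∀ i j → i <ᶠ j → E (π ⟨$⟩ʳ i) (π ⟨$⟩ʳ j) ⇔ (π ∘ₚ ρ′) ⟨$⟩ʳ i <ᶠ (π ∘ₚ ρ′) ⟨$⟩ʳ j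
  adjacency i j i<j = begin
    E k l                    ≈⟨ f-adj k l (λ k≡l → ≺⇒≢ {f k} {f l} fk≺fl (cong f k≡l)) ⟩
    URAdj (f k) (f l)        ≈⟨ URAdj⇔conj-≺ {f k} {f l} fk≺fl ⟩
    conj (f k) ≺ conj (f l)  ≈⟨ proj₂ by-w k l ⟩
    ρ′ ⟨$⟩ʳ k <ᶠ ρ′ ⟨$⟩ʳ l    ∎
    where
    k l : Fin n
    k = π ⟨$⟩ʳ i
    l = π ⟨$⟩ʳ j
    fk≺fl : f k ≺ f l
    fk≺fl = Equivalence.from (proj₂ by-u k l) (subst₂ _<ᶠ_ (sym (inverseʳ ρ)) (sym (inverseʳ ρ)) i<j)

-- The negative Pell equation p² − 2q² = −1

p+1≤3p+4q : ∀ {p q} → 1ℚ ≤ p → 0ℚ < q → p + 1ℚ ≤ 3ℚ * p + 4ℚ * q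
p+1≤3p+4q {p} {q} 1≤p 0<q =
  ≤-by (+-mono-≤ (p≤q⇒0≤q-p 1≤p) (<⇒≤ (+-pos (<-≤-trans 0<1 1≤p) (*-pos 0<4 0<q)))) (regroup p q)
  where
  regroup : ∀ p q → p + 1ℚ + ((p - 1ℚ) + (p + 4ℚ * q)) ≡ 3ℚ * p + 4ℚ * q
  regroup = solve-∀ ℚ-ring

record NegPell : Set where
  field
    p q  : ℚ
    norm : p * p - 2ℚ * (q * q) ≡ - 1ℚ
    1≤p  : 1ℚ ≤ p
    0<q  : 0ℚ < q

module _ (P : NegPell) where
  open NegPell P

  0<p : 0ℚ < p
  0<p = <-≤-trans 0<1 1≤p

  p²+1≡2q² : p * p + 1ℚ ≡ 2ℚ * (q * q)
  p²+1≡2q² = begin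
    p * p + 1ℚ                                  ≡⟨ regroup p q ⟩
    (p * p - 2ℚ * (q * q)) + 1ℚ + 2ℚ * (q * q)  ≡⟨ cong (λ z → z + 1ℚ + 2ℚ * (q * q)) norm ⟩
    - 1ℚ + 1ℚ + 2ℚ * (q * q)                    ≡⟨ +-identityˡ (2ℚ * (q * q)) ⟩
    2ℚ * (q * q)                                ∎
    where
    open ≡-Reasoning
    regroup : ∀ p q → p * p + 1ℚ ≡ (p * p - 2ℚ * (q * q)) + 1ℚ + 2ℚ * (q * q)
    regroup = solve-∀ ℚ-ring

  p/q : ℚ
  p/q = proj₁ (∃-quotient p 0<q)

  p/q*q≡p : p/q * q ≡ p
  p/q*q≡p = proj₂ (∃-quotient p 0<q)

  2q/p : ℚ
  2q/p = proj₁ (∃-quotient (2ℚ * q) 0<p)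

  2q/p*p≡2q : 2q/p * p ≡ 2ℚ * q
  2q/p*p≡2q = proj₂ (∃-quotient (2ℚ * q) 0<p)

  pell-bracket : Bracket
  pell-bracket = bracket p/q 2q/p p/q²<2 0<2q/p 2<2q/p²
    where
    open ≤-Reasoning
    p/q²<2 : p/q * p/q < 2ℚ
    p/q²<2 = *-cancelʳ-<-nonNeg (q * q) {{nonNegative (0≤p*p q)}} (begin-strict
      (p/q * p/q) * (q * q)   ≡⟨ product-square p/q q p/q*q≡p ⟩
      p * p                   <⟨ <-by 0<1 p²+1≡2q² ⟩
      2ℚ * (q * q)            ∎)
    0<2q/p : 0ℚ < 2q/p
    0<2q/p = *-cancelʳ-pos 0<p (subst (0ℚ <_) (sym 2q/p*p≡2q) (*-pos 0<2 0<q))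
    2<2q/p² : 2ℚ < 2q/p * 2q/p
    2<2q/p² = *-cancelʳ-<-nonNeg (p * p) {{nonNegative (0≤p*p p)}} (begin-strict
      2ℚ * (p * p)            <⟨ <-by 0<2 refl ⟩
      2ℚ * (p * p) + 2ℚ       ≡⟨ regroup p ⟩
      2ℚ * (p * p + 1ℚ)       ≡⟨ cong (2ℚ *_) p²+1≡2q² ⟩
      2ℚ * (2ℚ * (q * q))     ≡⟨ regroup′ q ⟩
      (2ℚ * q) * (2ℚ * q)     ≡⟨ product-square 2q/p p 2q/p*p≡2q ⟨
      (2q/p * 2q/p) * (p * p) ∎)
      where
      regroup : ∀ p → 2ℚ * (p * p) + 2ℚ ≡ 2ℚ * (p * p + 1ℚ)
      regroup = solve-∀ ℚ-ring
      regroup′ : ∀ q → 2ℚ * (2ℚ * (q * q)) ≡ (2ℚ * q) * (2ℚ * q)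
      regroup′ = solve-∀ ℚ-ring

  pell-PositiveOn : ∀ {D E} → 1ℚ ≤ D → E ≤ p → PositiveOn (p * (D + E)) (q * (D - E)) pell-bracket
  pell-PositiveOn {D} {E} 1≤D E≤p = at-p/q , at-2q/p
    where
    at-p/q : 0ℚ < p * (D + E) + q * (D - E) * p/q
    at-p/q = *-cancelʳ-pos 0<q (subst (0ℚ <_) (sym scaled) (*-pos (*-pos 0<2 (*-pos 0<p 0<q)) (<-≤-trans 0<1 1≤D)))
      where
      open ≡-Reasoning
      scaled : (p * (D + E) + q * (D - E) * p/q) * q ≡ 2ℚ * (p * q) * D
      scaled = begin
        (p * (D + E) + q * (D - E) * p/q) * q   ≡⟨ regroup p q D E p/q ⟩
        p * (D + E) * q + q * (D - E) * (p/q * q) ≡⟨ cong (λ z → p * (D + E) * q + q * (D - E) * z) p/q*q≡p ⟩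
        p * (D + E) * q + q * (D - E) * p       ≡⟨ regroup′ p q D E ⟩
        2ℚ * (p * q) * D                        ∎
        where
        regroup : ∀ p q D E l → (p * (D + E) + q * (D - E) * l) * q ≡ p * (D + E) * q + q * (D - E) * (l * q)
        regroup = solve-∀ ℚ-ring
        regroup′ : ∀ p q D E → p * (D + E) * q + q * (D - E) * p ≡ 2ℚ * (p * q) * D
        regroup′ = solve-∀ ℚ-ring
    at-2q/p : 0ℚ < p * (D + E) + q * (D - E) * 2q/p
    at-2q/p = *-cancelʳ-pos 0<p (subst (0ℚ <_) (sym scaled) (p<q⇒0<q-p E<[2p²+1]D))
      where
      scaled : (p * (D + E) + q * (D - E) * 2q/p) * p ≡ (2ℚ * (p * p) + 1ℚ) * D - E
      scaled = begin
        (p * (D + E) + q * (D - E) * 2q/p) * p       ≡⟨ regroup p q D E 2q/p ⟩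
        p * p * (D + E) + q * (D - E) * (2q/p * p)   ≡⟨ cong (λ z → p * p * (D + E) + q * (D - E) * z) 2q/p*p≡2q ⟩
        p * p * (D + E) + q * (D - E) * (2ℚ * q)     ≡⟨ regroup′ p q D E ⟩
        p * p * (D + E) + 2ℚ * (q * q) * (D - E)     ≡⟨ cong (λ z → p * p * (D + E) + z * (D - E)) p²+1≡2q² ⟨
        p * p * (D + E) + (p * p + 1ℚ) * (D - E)     ≡⟨ regroup″ p D E ⟩
        (2ℚ * (p * p) + 1ℚ) * D - E                  ∎
        where
        open ≡-Reasoning
        regroup : ∀ p q D E h → (p * (D + E) + q * (D - E) * h) * p ≡ p * p * (D + E) + q * (D - E) * (h * p)
        regroup = solve-∀ ℚ-ring
        regroup′ : ∀ p q D E → p * p * (D + E) + q * (D - E) * (2ℚ * q) ≡ p * p * (D + E) + 2ℚ * (q * q) * (D - E)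
        regroup′ = solve-∀ ℚ-ring
        regroup″ : ∀ p D E → p * p * (D + E) + (p * p + 1ℚ) * (D - E) ≡ (2ℚ * (p * p) + 1ℚ) * D - E
        regroup″ = solve-∀ ℚ-ring
      E<[2p²+1]D : E < (2ℚ * (p * p) + 1ℚ) * D
      E<[2p²+1]D = begin-strict
        E                           ≤⟨ E≤p ⟩
        p                           ≡⟨ *-identityʳ p ⟨
        p * 1ℚ                      ≤⟨ *-monoˡ-≤-nonNeg p {{nonNegative (<⇒≤ 0<p)}} 1≤p ⟩
        p * p                       <⟨ <-by (+-mono-≤-< (0≤p*p p) 0<1) (regroup p) ⟩
        2ℚ * (p * p) + 1ℚ           ≡⟨ *-identityʳ (2ℚ * (p * p) + 1ℚ) ⟨
        (2ℚ * (p * p) + 1ℚ) * 1ℚ    ≤⟨ *-monoˡ-≤-nonNeg (2ℚ * (p * p) + 1ℚ) {{nonNegative 0≤2p²+1}} 1≤D ⟩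
        (2ℚ * (p * p) + 1ℚ) * D     ∎
        where
        open ≤-Reasoning
        regroup : ∀ p → p * p + (p * p + 1ℚ) ≡ 2ℚ * (p * p) + 1ℚ
        regroup = solve-∀ ℚ-ring
        0≤2p²+1 : 0ℚ ≤ 2ℚ * (p * p) + 1ℚ
        0≤2p²+1 = +-mono-≤ (*-nonNeg (<⇒≤ 0<2) (0≤p*p p)) (<⇒≤ 0<1)

  pell-pos : ∀ {D E} → 1ℚ ≤ D → E ≤ p → Pos√2 (p * (D + E)) (q * (D - E))
  pell-pos 1≤D E≤p = PositiveOn⇒Pos√2 pell-bracket (pell-PositiveOn 1≤D E≤p)

  -- u = α x + β y and w = β x + α y, for α = p + q√2 and β = p − q√2.
  embed : ℚ → ℚ → V
  embed x y = p * (x + y) , q * (x - y)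

  embed-≺ : ∀ {x y x′ y′} → 1ℚ ≤ x′ - x → y′ - y ≤ p → embed x y ≺ embed x′ y′
  embed-≺ {x} {y} {x′} {y′} 1≤Δx Δy≤p =
    subst₂ Pos√2 (diff-+ p x y x′ y′) (diff-- q x y x′ y′) (pell-pos 1≤Δx Δy≤p)
    where
    diff-+ : ∀ p x y x′ y′ → p * ((x′ - x) + (y′ - y)) ≡ p * (x′ + y′) - p * (x + y)
    diff-+ = solve-∀ ℚ-ring
    diff-- : ∀ q x y x′ y′ → q * ((x′ - x) - (y′ - y)) ≡ q * (x′ - y′) - q * (x - y)
    diff-- = solve-∀ ℚ-ring

  conj-embed : ∀ x y → conj (embed x y) ≡ embed y x
  conj-embed x y = cong₂ _,_ (cong (p *_) (+-comm x y)) (neg-diff q x y)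
    where
    neg-diff : ∀ q x y → - (q * (x - y)) ≡ q * (y - x)
    neg-diff = solve-∀ ℚ-ring

pell-next : NegPell → NegPell
pell-next P = record
  { p    = 3ℚ * p + 4ℚ * q
  ; q    = 2ℚ * p + 3ℚ * q
  ; norm = trans (pell-norm p q) norm
  ; 1≤p  = ≤-trans 1≤p (≤-trans (<⇒≤ (<-by 0<1 refl)) (p+1≤3p+4q 1≤p 0<q))
  ; 0<q  = +-pos (*-pos 0<2 (0<p P)) (*-pos 0<3 0<q)
  }
  where open NegPell P

toℚ : ℕ → ℚ
toℚ zero    = 0ℚ
toℚ (suc m) = toℚ m + 1ℚ

pell-large : ∀ m → Σ NegPell λ P → toℚ m ≤ NegPell.p P
pell-large zero    = record { p = 1ℚ ; q = 1ℚ ; norm = refl ; 1≤p = ≤-refl ; 0<q = 0<1 } , <⇒≤ 0<1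
pell-large (suc m) =
  let P , m≤p = pell-large m
  in pell-next P , ≤-trans (+-monoˡ-≤ 1ℚ m≤p) (p+1≤3p+4q (NegPell.1≤p P) (NegPell.0<q P))

toℚ-mono-≤ : ∀ {m n} → m ℕ.≤ n → toℚ m ≤ toℚ n
toℚ-mono-≤ {n = zero}  ℕ.z≤n = ≤-refl
toℚ-mono-≤ {n = suc n} m≤1+n with ℕ.m≤n⇒m<n∨m≡n m≤1+n
... | inj₁ m<1+n = ≤-trans (toℚ-mono-≤ (ℕ.s≤s⁻¹ m<1+n)) (≤-by (<⇒≤ 0<1) refl)
... | inj₂ refl  = ≤-refl

toℚ-gap : ∀ {m n} → m ℕ.< n → 1ℚ ≤ toℚ n - toℚ m
toℚ-gap m<n = p+r≤q⇒r≤q-p (toℚ-mono-≤ m<n)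

toℚ-spread : ∀ m n → toℚ n - toℚ m ≤ toℚ n
toℚ-spread m n = q-p≤q (toℚ-mono-≤ {0} {m} ℕ.z≤n)

⟨$⟩ˡ-injective : ∀ {n} (π : Permutation′ n) → Injective _≡_ _≡_ (π ⟨$⟩ˡ_)
⟨$⟩ˡ-injective π eq = trans (sym (inverseʳ π)) (trans (cong (π ⟨$⟩ʳ_) eq) (inverseʳ π))

permutation⇒induced : ∀ H → IsPermutationGraph H → IsInducedSubgraphOfUR H
permutation⇒induced H (π , σ , adj) = f , f-inj , f-adj
  where
  open FinGraph H using (n; E) renaming (sym to E-sym)
  open import Relation.Binary.Reasoning.Setoid (⇔-setoid 0ℓ)
  P : NegPell
  P = proj₁ (pell-large n)
  n≤p : toℚ n ≤ NegPell.p P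
  n≤p = proj₂ (pell-large n)
  x y : Fin n → ℚ
  x i = toℚ (toℕ i)
  y i = toℚ (toℕ (σ ⟨$⟩ʳ i))
  pos : Fin n → V
  pos i = embed P (x i) (y i)
  spread≤p : ∀ (i j : Fin n) → toℚ (toℕ j) - toℚ (toℕ i) ≤ NegPell.p P
  spread≤p i j = ≤-trans (toℚ-spread (toℕ i) (toℕ j)) (≤-trans (toℚ-mono-≤ (ℕ.<⇒≤ (toℕ<n j))) n≤p)
  pos-≺ : ∀ {i j} → i <ᶠ j → pos i ≺ pos j
  pos-≺ {i} {j} i<j = embed-≺ P {x i} {y i} {x j} {y j} (toℚ-gap i<j) (spread≤p (σ ⟨$⟩ʳ i) (σ ⟨$⟩ʳ j))
  conj-pos-≺ : ∀ {i j} → σ ⟨$⟩ʳ i <ᶠ σ ⟨$⟩ʳ j → conj (pos i) ≺ conj (pos j)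
  conj-pos-≺ {i} {j} σi<σj = subst₂ _≺_ (sym (conj-embed P (x i) (y i))) (sym (conj-embed P (x j) (y j)))
    (embed-≺ P {y i} {x i} {y j} {x j} (toℚ-gap σi<σj) (spread≤p i j))
  conj-pos-reflects : ∀ {i j} → conj (pos i) ≺ conj (pos j) → σ ⟨$⟩ʳ i <ᶠ σ ⟨$⟩ʳ j
  conj-pos-reflects {i} {j} c with <ᶠ-cmp (σ ⟨$⟩ʳ i) (σ ⟨$⟩ʳ j)
  ... | tri< σi<σj _ _ = σi<σj
  ... | tri≈ _ σi≡σj _ = contradiction (subst (λ k → conj (pos i) ≺ conj (pos k)) (sym i≡j) c) (≺-irrefl {conj (pos i)})
    where
    i≡j : i ≡ j
    i≡j = trans (sym (inverseˡ σ)) (trans (cong (σ ⟨$⟩ˡ_) σi≡σj) (inverseˡ σ))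
  ... | tri> _ _ σj<σi = contradiction (conj-pos-≺ σj<σi) (≺-asym {conj (pos i)} {conj (pos j)} c)
  URAdj-pos : ∀ {i j} → i <ᶠ j → URAdj (pos i) (pos j) ⇔ σ ⟨$⟩ʳ i <ᶠ σ ⟨$⟩ʳ j
  URAdj-pos {i} {j} i<j = begin
    URAdj (pos i) (pos j)        ≈⟨ URAdj⇔conj-≺ {pos i} {pos j} (pos-≺ i<j) ⟩
    conj (pos i) ≺ conj (pos j)  ≈⟨ mk⇔ conj-pos-reflects conj-pos-≺ ⟩
    σ ⟨$⟩ʳ i <ᶠ σ ⟨$⟩ʳ j          ∎
  E⇔URAdj : ∀ i j → i ≢ j → E (π ⟨$⟩ʳ i) (π ⟨$⟩ʳ j) ⇔ URAdj (pos i) (pos j)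
  E⇔URAdj i j i≢j with <ᶠ-cmp i j
  ... | tri< i<j _ _ = begin
    E (π ⟨$⟩ʳ i) (π ⟨$⟩ʳ j)  ≈⟨ adj i j i<j ⟩
    σ ⟨$⟩ʳ i <ᶠ σ ⟨$⟩ʳ j     ≈⟨ URAdj-pos i<j ⟨
    URAdj (pos i) (pos j)    ∎
  ... | tri≈ _ i≡j _ = contradiction i≡j i≢j
  ... | tri> _ _ j<i = begin
    E (π ⟨$⟩ʳ i) (π ⟨$⟩ʳ j)  ≈⟨ mk⇔ E-sym E-sym ⟩
    E (π ⟨$⟩ʳ j) (π ⟨$⟩ʳ i)  ≈⟨ adj j i j<i ⟩
    σ ⟨$⟩ʳ j <ᶠ σ ⟨$⟩ʳ i     ≈⟨ URAdj-pos j<i ⟨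
    URAdj (pos j) (pos i)    ≈⟨ mk⇔ URAdj-sym URAdj-sym ⟩
    URAdj (pos i) (pos j)    ∎
  pos-injective : Injective _≡_ _≡_ pos
  pos-injective {i} {j} eq with <ᶠ-cmp i j
  ... | tri< i<j _ _ = contradiction eq (≺⇒≢ {pos i} {pos j} (pos-≺ i<j))
  ... | tri≈ _ i≡j _ = i≡j
  ... | tri> _ _ j<i = contradiction (sym eq) (≺⇒≢ {pos j} {pos i} (pos-≺ j<i))
  f : Fin n → V
  f k = pos (π ⟨$⟩ˡ k)
  f-inj : Injective _≡_ _≡_ f
  f-inj eq = ⟨$⟩ˡ-injective π (pos-injective eq)
  f-adj : ∀ k l → k ≢ l → E k l ⇔ URAdj (f k) (f l)
  f-adj k l k≢l = subst₂ (λ k′ l′ → E k′ l′ ⇔ URAdj (f k) (f l)) (inverseʳ π) (inverseʳ π)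
    (E⇔URAdj (π ⟨$⟩ˡ k) (π ⟨$⟩ˡ l) (λ eq → k≢l (⟨$⟩ˡ-injective π eq)))

lemma7p1 : (H : FinGraph) → IsInducedSubgraphOfUR H ⇔ IsPermutationGraph H
lemma7p1 H = mk⇔ (induced⇒permutation H) (permutation⇒induced H)
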